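{- Let $T$ be a tournament, $k$ a positive integer, and let $O$ be the set of vertices of $T$ that are initial vertices of a directed path of order $k$ in $T$. Then every vertex of $O$ dominates every vertex of $V(T)\setminus O$ (i.e. $uv\in A(T)$ for all $u\in O$, $v\in V(T)\setminus O$).
   Context: A directed path of order $k$ is a directed path with $k$ vertices; its initial vertex is its first vertex. -}

module Defs where

open import Data.Nat using (ℕ; suc)
open import Data.Fin using (Fin; zero; suc; inject₁)
open import Data.Product using (Σ; _×_)
open import Data.Sum using (_⊎_)
open import Relation.Nullary using (¬_)
open import Relation.Binary.PropositionalEquality using (_≡_; _≢_)
open import Function.Definitions using (Injective)

record Tournament (n : ℕ) : Set₁ where
  field
    Arc         : Fin n → Fin n → Set
    irreflexive : ∀ v → ¬ Arc v v
    total       : ∀ u v → u ≢ v → Arc u v ⊎ Arc v u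
    antisym     : ∀ u v → Arc u v → ¬ Arc v u

open Tournament public

-- A directed path of order suc m (i.e. with suc m ≥ 1 vertices) in T:
-- pairwise distinct vertices p 0, …, p m with an arc p i → p (i+1).
record DiPath {n : ℕ} (T : Tournament n) (m : ℕ) : Set where
  field
    vertex    : Fin (suc m) → Fin n
    injective : Injective _≡_ _≡_ vertex
    arcs      : ∀ (i : Fin m) → Arc T (vertex (inject₁ i)) (vertex (suc i))

open DiPath public

IsInitial : ∀ {n} (T : Tournament n) (m : ℕ) → Fin n → Set
IsInitial T m u = Σ (DiPath T m) λ P → vertex P zero ≡ u

{-# OPTIONS --safe #-}
-- If u starts a path u p₁ … pₘ and v → u, then v also starts a path of
-- order m + 1.  When v is off the path, take v u p₁ … pₘ₋₁.  Otherwise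
-- v = pⱼ and v u p₁ … pⱼ₋₁ is a path; the remaining vertices pⱼ₊₁, …, pₘ
-- are inserted into it one by one as in Rédei's proof that tournaments have
-- Hamiltonian paths: each of them is dominated by its predecessor, which is
-- already on the path.  So the set O is closed under in-neighbours, and by
-- totality every arc between O and its complement leaves O.
module Submission where

open import Defs
open import Level using (Level)
open import Data.Nat using (ℕ; zero; suc)
open import Data.Nat.Properties using (suc-injective)
open import Data.Fin using (Fin; zero; suc; inject₁; _≟_)
open import Data.Fin.Properties using (inject₁-injective)
open import Data.List using (List; []; _∷_; _++_; length; lookup; tabulate)
open import Data.List.Properties using (length-tabulate; ++-identityʳ)
open import Data.List.Relation.Unary.Any using (Any; here; there)
import Data.List.Relation.Unary.All as All
open import Data.List.Relation.Unary.All.Properties using (¬Any⇒All¬)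
open import Data.List.Relation.Unary.AllPairs using (_∷_)
open import Data.List.Relation.Unary.Linked as Linked using (Linked; []; [-]; _∷_)
open import Data.List.Relation.Unary.Unique.Propositional using (Unique)
import Data.List.Relation.Unary.Unique.Propositional.Properties as Unique
open import Data.List.Membership.Propositional using (_∈_; _∉_; lose)
open import Data.List.Membership.Propositional.Properties using (∈-∃++; ∈-lookup; ∈-++⁺ˡ)
open import Data.List.Relation.Binary.Permutation.Propositional
  using (_↭_; refl; prep; swap; trans; ↭-sym; ↭-reflexive; ↭⇒↭ₛ)
open import Data.List.Relation.Binary.Permutation.Propositional.Properties
  using (∈-resp-↭; ↭-length; shift; ++⁺ʳ)
import Data.List.Relation.Binary.Permutation.Setoid.Properties as PermutationSetoid
open import Data.Product using (∃-syntax; _×_; _,_)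
open import Data.Sum using (inj₁; inj₂)
open import Data.Empty using (⊥-elim)
open import Relation.Binary.Core using (Rel)
open import Relation.Nullary using (¬_; yes; no)
open import Relation.Binary.PropositionalEquality
  using (_≡_; refl; sym; cong; setoid)
  renaming (trans to ≡-trans)

private
  variable
    a r : Level
    A : Set a
    R : Rel A r

Unique-resp-↭ : {xs ys : List A} → xs ↭ ys → Unique xs → Unique ys
Unique-resp-↭ {A = A} π = PermutationSetoid.Unique-resp-↭ (setoid A) (↭⇒↭ₛ π)

Unique-lookup-injective : {xs : List A} → Unique xs →
                          ∀ {i j} → lookup xs i ≡ lookup xs j → i ≡ j
Unique-lookup-injective (_  ∷ _) {zero}  {zero}  _  = refl
Unique-lookup-injective (x∉ ∷ _) {zero}  {suc j} eq = ⊥-elim (All.lookup x∉ (∈-lookup j) eq)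
Unique-lookup-injective (x∉ ∷ _) {suc i} {zero}  eq = ⊥-elim (All.lookup x∉ (∈-lookup i) (sym eq))
Unique-lookup-injective (_  ∷ U) {suc i} {suc j} eq = cong suc (Unique-lookup-injective U eq)

Linked-lookup : ∀ {x xs} → Linked R (x ∷ xs) →
                (i : Fin (length xs)) → R (lookup (x ∷ xs) (inject₁ i)) (lookup xs i)
Linked-lookup (Rxy ∷ _)   zero    = Rxy
Linked-lookup (_   ∷ Rxs) (suc i) = Linked-lookup Rxs i

Linked-tabulate⁺ : ∀ {m} (f : Fin (suc m) → A) →
                   (∀ i → R (f (inject₁ i)) (f (suc i))) → Linked R (tabulate f)
Linked-tabulate⁺ {m = zero}  f _  = [-]
Linked-tabulate⁺ {m = suc m} f Rf = Rf zero ∷ Linked-tabulate⁺ (λ i → f (suc i)) (λ i → Rf (suc i))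

Linked-++⁻ˡ : ∀ xs {ys} → Linked R (xs ++ ys) → Linked R xs
Linked-++⁻ˡ []           _           = []
Linked-++⁻ˡ (x ∷ [])     _           = [-]
Linked-++⁻ˡ (x ∷ y ∷ xs) (Rxy ∷ Rxs) = Rxy ∷ Linked-++⁻ˡ (y ∷ xs) Rxs

Linked-++⁻ʳ : ∀ xs {ys} → Linked R (xs ++ ys) → Linked R ys
Linked-++⁻ʳ []       Rys   = Rys
Linked-++⁻ʳ (x ∷ xs) Rxsys = Linked-++⁻ʳ xs (Linked.tail Rxsys)

module _ {n : ℕ} (T : Tournament n) where

  open import Data.List.Membership.DecPropositional (_≟_ {n}) using (_∈?_)

  WalkFrom : Fin n → List (Fin n) → Set
  WalkFrom q xs = ∃[ rs ] Linked (Arc T) (q ∷ rs) × rs ↭ xs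

  WalkFrom-∷ : ∀ {q q′ x qs} → Arc T q q′ → WalkFrom q′ (x ∷ qs) → WalkFrom q (x ∷ q′ ∷ qs)
  WalkFrom-∷ q→q′ (rs , L , π) = _ ∷ rs , q→q′ ∷ L , trans (prep _ π) (swap _ _ refl)

  -- Rédei's insertion step: scanning forward from a vertex c → x, x is placed
  -- before the first later vertex that it dominates, or at the end.
  insert : ∀ {x q qs} → Linked (Arc T) (q ∷ qs) → x ∉ q ∷ qs →
           Any (λ c → Arc T c x) (q ∷ qs) → WalkFrom q (x ∷ qs)
  insert [-] _ (here q→x) = _ , q→x ∷ [-] , refl
  insert [-] _ (there ())
  insert (q→q′ ∷ L) x∉ (there x←) = WalkFrom-∷ q→q′ (insert L (λ x∈ → x∉ (there x∈)) x←)
  insert {x} {qs = q′ ∷ qs} (q→q′ ∷ L) x∉ (here q→x)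
    with total T x q′ (λ x≡q′ → x∉ (there (here x≡q′)))
  ... | inj₁ x→q′ = x ∷ q′ ∷ qs , q→x ∷ x→q′ ∷ L , refl
  ... | inj₂ q′→x = WalkFrom-∷ q→q′ (insert L (λ x∈ → x∉ (there x∈)) (here q′→x))

  absorb : ∀ {q qs p ts} → Linked (Arc T) (q ∷ qs) → Linked (Arc T) (p ∷ ts) →
           p ∈ q ∷ qs → Unique (q ∷ qs ++ ts) → WalkFrom q (qs ++ ts)
  absorb {qs = qs} {ts = []} L _ _ _ = qs , L , ↭-reflexive (sym (++-identityʳ qs))
  absorb {q} {qs} {ts = t ∷ ts} L (p→t ∷ Lt) p∈ U =
    let (rs , L′ , π) = insert L t∉ (lose p∈ p→t)
        π′ = trans (++⁺ʳ ts π) (↭-sym (shift t qs ts))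
        t∈ = there (∈-resp-↭ (↭-sym π) (here refl))
        (ws , L″ , π″) = absorb L′ Lt t∈ (Unique-resp-↭ (↭-sym (prep q π′)) U)
    in ws , L″ , trans π″ π′
    where
    t∉ : t ∉ q ∷ qs
    t∉ t∈ = Unique.Unique[x∷xs]⇒x∉xs (Unique-resp-↭ (shift t (q ∷ qs) ts) U) (∈-++⁺ˡ t∈)

  Linked⇒IsInitial : ∀ {m v ws} → Linked (Arc T) (v ∷ ws) → Unique (v ∷ ws) →
                     length ws ≡ m → IsInitial T m v
  Linked⇒IsInitial {ws = ws} L U refl =
    record { vertex    = lookup (_ ∷ ws)
           ; injective = Unique-lookup-injective U
           ; arcs      = Linked-lookup L } , refl

  IsInitial-shorten : ∀ {m v} → IsInitial T (suc m) v → IsInitial T m v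
  IsInitial-shorten (P , P₀≡v) =
    record { vertex    = λ i → vertex P (inject₁ i)
           ; injective = λ eq → inject₁-injective (injective P eq)
           ; arcs      = λ i → arcs P (inject₁ i) } , P₀≡v

  dominator-starts-path : ∀ {m u v us} → Linked (Arc T) (u ∷ us) → Unique (u ∷ us) →
                          length us ≡ m → Arc T v u → IsInitial T m v
  dominator-starts-path {u = u} {v} {us} L U len v→u with v ∈? u ∷ us
  ... | no v∉ = IsInitial-shorten (Linked⇒IsInitial (v→u ∷ L) (¬Any⇒All¬ _ v∉ ∷ U) (cong suc len))
  ... | yes (here refl) = ⊥-elim (irreflexive T v v→u)
  ... | yes (there v∈us) with A , B , refl ← ∈-∃++ v∈us =
    let σ = shift v (u ∷ A) B
        (ws , L′ , π) = absorb (v→u ∷ Linked-++⁻ˡ (u ∷ A) L) (Linked-++⁻ʳ (u ∷ A) L)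
                               (here refl) (Unique-resp-↭ σ U)
        τ = trans (prep v π) (↭-sym σ)
    in Linked⇒IsInitial L′ (Unique-resp-↭ (↭-sym τ) U) (≡-trans (suc-injective (↭-length τ)) len)

  IsInitial-dominator : ∀ {m u v} → IsInitial T m u → Arc T v u → IsInitial T m v
  IsInitial-dominator (P , refl) =
    dominator-starts-path (Linked-tabulate⁺ (vertex P) (arcs P)) (Unique.tabulate⁺ (injective P))
                          (length-tabulate _)

lemma15 : ∀ {n : ℕ} (T : Tournament n) (m : ℕ) (u v : Fin n) →
          IsInitial T m u → ¬ IsInitial T m v → Arc T u v
lemma15 T m u v u∈O v∉O with u ≟ v
... | yes refl = ⊥-elim (v∉O u∈O)
... | no u≢v with total T u v u≢v
...   | inj₁ u→v = u→v
...   | inj₂ v→u = ⊥-elim (v∉O (IsInitial-dominator T u∈O v→u))
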